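{- Let $\Gamma$ be a connected graph and let $n\geq 3$ be an integer. Then $$\mathrm{src}(\Gamma\square C_n)\leq \left\lceil\frac{n-2}{2}\right\rceil+\mathrm{src}(\Gamma\square C_2).$$
   Context: All graphs are finite and simple; $C_n$ is the cycle on $n$ vertices and $C_2$ denotes the graph with two vertices joined by a single edge. An edge-coloring $\zeta:E(\Gamma)\to\{1,\ldots,k\}$ (adjacent edges may share colors) is a strong rainbow $k$-coloring if every two distinct vertices $u,v$ are joined by a path of length $d(u,v)$ (the graph distance) whose edges have pairwise distinct colors. The strong rainbow connection number $\mathrm{src}(\Gamma)$ is the minimum $k$ for which a strong rainbow $k$-coloring of $\Gamma$ exists. The Cartesian product $\Gamma\square\Lambda$ has vertex set $V(\Gamma)\times V(\Lambda)$, with $(\gamma,\lambda)$ adjacent to $(\gamma',\lambda')$ iff either $\lambda=\lambda'$ and $\gamma\gamma'\in E(\Gamma)$, or $\gamma=\gamma'$ and $\lambda\lambda'\in E(\Lambda)$. -}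

module Defs where

open import Data.Nat using (ℕ; zero; suc; _≤_)
open import Data.Fin using (Fin; toℕ)
open import Data.Product using (Σ; _×_; _,_)
open import Data.Sum using (_⊎_)
open import Data.List using (List; []; _∷_)
open import Data.List.Relation.Unary.Unique.Propositional using (Unique)
open import Relation.Binary.PropositionalEquality using (_≡_; _≢_)
open import Relation.Nullary using (¬_)

record Graph : Set₁ where
  constructor mkGraph
  field
    V : Set
    E : V → V → Set
open Graph public

IsSimple : Graph → Set
IsSimple G = (∀ u v → E G u v → E G v u) × (∀ u → ¬ E G u u)

data Walk (G : Graph) : V G → V G → Set where
  []  : ∀ {u} → Walk G u u
  _∷_ : ∀ {u w v} → E G u w → Walk G w v → Walk G u v

length : ∀ {G u v} → Walk G u v → ℕ
length []      = 0
length (_ ∷ p) = suc (length p)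

Connected : Graph → Set
Connected G = ∀ u v → Walk G u v

IsGeodesic : ∀ {G u v} → Walk G u v → Set
IsGeodesic {G} {u} {v} p = ∀ (q : Walk G u v) → length p ≤ length q

colours : ∀ {G k} → (V G → V G → Fin k) → ∀ {u v} → Walk G u v → List (Fin k)
colours c ([] )                  = []
colours {G} c (_∷_ {u} {w} _ p)  = c u w ∷ colours c p

-- edge colouring with colours {1..k} ≅ Fin k: a symmetric function on
-- vertex pairs (only its values on edges matter)
IsEdgeColouring : (G : Graph) (k : ℕ) → (V G → V G → Fin k) → Set
IsEdgeColouring G k c = ∀ u v → E G u v → c u v ≡ c v u

IsStrongRainbowColouring : (G : Graph) (k : ℕ) → (V G → V G → Fin k) → Set
IsStrongRainbowColouring G k c =
  IsEdgeColouring G k c ×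
  (∀ u v → u ≢ v → Σ (Walk G u v) (λ p → IsGeodesic p × Unique (colours c p)))

-- G has a strong rainbow k-colouring  (so src G ≤ k iff this holds)
HasStrongRainbow : Graph → ℕ → Set
HasStrongRainbow G k = Σ (V G → V G → Fin k) (IsStrongRainbowColouring G k)

-- the cycle C_n on Fin n (for n = 2 this is the single edge {0,1})
CycleAdj : (n : ℕ) → Fin n → Fin n → Set
CycleAdj n i j =
  (toℕ j ≡ suc (toℕ i)) ⊎ (toℕ i ≡ suc (toℕ j)) ⊎
  ((toℕ i ≡ 0 × suc (toℕ j) ≡ n) ⊎ (toℕ j ≡ 0 × suc (toℕ i) ≡ n))

Cycle : ℕ → Graph
Cycle n = mkGraph (Fin n) (CycleAdj n)

_□_ : Graph → Graph → Graph
G □ H = mkGraph (V G × V H) adj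
  where
  adj : V G × V H → V G × V H → Set
  adj (g , h) (g' , h') = (h ≡ h' × E G g g') ⊎ (g ≡ g' × E H h h')

module Submission where

-- Write n = a + b + 2 with a = ⌈(n-2)/2⌉, b = ⌊(n-2)/2⌋, and cut C_n into side A
-- (positions 0 … a) and side B (positions a+1 … n-1), joined by the middle edge
-- and the wrap-around edge; side : C_n → C₂ records the side of a vertex. The
-- edges inside each side are coloured 0, 1, 2, … (a colours), the two joining
-- edges stay unlabelled, and every two vertices of C_n are joined by an arc: a
-- geodesic with distinct colours crossing exactly d_C₂(side i, side j) unlabelled
-- edges. Given a strong rainbow colouring ζ of Γ □ C₂, an edge of the layer
-- Γ × {i} takes the ζ-colour of its copy in Γ × {side i}, and an edge of {g} × C_n
-- its C_n-colour, or the colour of the rung {g} × C₂ when unlabelled. A geodesic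
-- of Γ □ C₂ consists of two layer walks around at most one rung; replacing the
-- rung by an arc gives a geodesic of Γ □ C_n (distances add up in Cartesian
-- products) whose colours are those of the two rainbow walks, hence distinct.

open import Defs
open import Data.Nat using (ℕ; zero; suc; _≤_; _<_; _+_; _∸_; z≤n; s≤s; ∣_-_∣; ⌊_/2⌋; ⌈_/2⌉)
open import Data.Nat.Properties
open import Data.Nat.Tactic.RingSolver using (solve-∀)
open import Data.Fin using (Fin; toℕ; fromℕ<; fromℕ; join; splitAt)
import Data.Fin as F
open import Data.Fin.Properties using (toℕ-fromℕ<; toℕ-fromℕ; toℕ-injective; toℕ<n; splitAt-join)
open import Data.Product using (Σ; _×_; _,_; proj₁; proj₂)
open import Data.Product.Properties using (≡-dec)
open import Data.Sum using (_⊎_; inj₁; inj₂; swap)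
open import Data.Sum.Properties using (inj₁-injective; inj₂-injective)
open import Data.Maybe using (Maybe; just; nothing)
import Data.Maybe as Maybe
open import Data.List using (List; []; _∷_; _++_; map; reverse; [_]; catMaybes; replicate)
open import Data.List.Properties using (unfold-reverse; ++-identityʳ; catMaybes-++; map-catMaybes; map-++)
open import Data.List.Relation.Unary.All as All using (All; []; _∷_)
open import Data.List.Relation.Unary.Unique.Propositional using (Unique; []; _∷_)
open import Data.List.Relation.Unary.Unique.Propositional.Properties using (map⁺; map⁻; ++⁺)
open import Data.List.Relation.Binary.Disjoint.Propositional using (Disjoint)
import Data.List.Relation.Binary.Permutation.Setoid.Properties as Permutation
open import Data.Empty using (⊥-elim)
open import Relation.Nullary using (¬_; yes; no)
open import Relation.Binary.Definitions using (DecidableEquality)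
open import Relation.Binary.PropositionalEquality using (_≡_; _≢_; refl; sym; trans; cong; cong₂; subst; setoid; module ≡-Reasoning)

Unique-reverse : {A : Set} {xs : List A} → Unique xs → Unique (reverse xs)
Unique-reverse {A} {xs} = Unique-resp-↭ (↭-sym (↭-reverse xs))
  where open Permutation (setoid A)
        open import Data.List.Relation.Binary.Permutation.Setoid (setoid A) using (↭-sym)

module _ {A B : Set} where
  lefts : List (A ⊎ B) → List A
  lefts []           = []
  lefts (inj₁ a ∷ l) = a ∷ lefts l
  lefts (inj₂ _ ∷ l) = lefts l

  rights : List (A ⊎ B) → List B
  rights []           = []
  rights (inj₁ _ ∷ l) = rights l
  rights (inj₂ b ∷ l) = b ∷ rights l

  lefts-++ : (l l' : List (A ⊎ B)) → lefts (l ++ l') ≡ lefts l ++ lefts l'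
  lefts-++ []           l' = refl
  lefts-++ (inj₁ a ∷ l) l' = cong (a ∷_) (lefts-++ l l')
  lefts-++ (inj₂ _ ∷ l) l' = lefts-++ l l'

  rights-++ : (l l' : List (A ⊎ B)) → rights (l ++ l') ≡ rights l ++ rights l'
  rights-++ []           l' = refl
  rights-++ (inj₁ _ ∷ l) l' = rights-++ l l'
  rights-++ (inj₂ b ∷ l) l' = cong (b ∷_) (rights-++ l l')

  lefts-inj₂ : (l : List B) → lefts (map inj₂ l) ≡ []
  lefts-inj₂ []      = refl
  lefts-inj₂ (_ ∷ l) = lefts-inj₂ l

  rights-inj₂ : (l : List B) → rights (map inj₂ l) ≡ l
  rights-inj₂ []      = refl
  rights-inj₂ (b ∷ l) = cong (b ∷_) (rights-inj₂ l)

  Unique-components : (l : List (A ⊎ B)) → Unique (lefts l) → Unique (rights l) → Unique l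
  Unique-components []           _        _        = []
  Unique-components (inj₁ a ∷ l) (a∉ ∷ L) R        = fresh l a∉ ∷ Unique-components l L R
    where
    fresh : ∀ l → All (a ≢_) (lefts l) → All (inj₁ a ≢_) l
    fresh []            _         = []
    fresh (inj₁ a' ∷ l) (a≢ ∷ ps) = (λ eq → a≢ (inj₁-injective eq)) ∷ fresh l ps
    fresh (inj₂ _ ∷ l)  ps        = (λ ()) ∷ fresh l ps
  Unique-components (inj₂ b ∷ l) L        (b∉ ∷ R) = fresh l b∉ ∷ Unique-components l L R
    where
    fresh : ∀ l → All (b ≢_) (rights l) → All (inj₂ b ≢_) l
    fresh []            _         = []
    fresh (inj₂ b' ∷ l) (b≢ ∷ ps) = (λ eq → b≢ (inj₂-injective eq)) ∷ fresh l ps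
    fresh (inj₁ _ ∷ l)  ps        = (λ ()) ∷ fresh l ps

module _ {G : Graph} where
  infixr 5 _++ʷ_
  _++ʷ_ : ∀ {u v w} → Walk G u v → Walk G v w → Walk G u w
  []      ++ʷ q = q
  (e ∷ p) ++ʷ q = e ∷ (p ++ʷ q)

  length-++ʷ : ∀ {u v w} (p : Walk G u v) (q : Walk G v w) →
               length (p ++ʷ q) ≡ length p + length q
  length-++ʷ []      q = refl
  length-++ʷ (e ∷ p) q = cong suc (length-++ʷ p q)

  labels : {A : Set} → (V G → V G → A) → ∀ {u v} → Walk G u v → List A
  labels c []                  = []
  labels c (_∷_ {u} {w} _ p)   = c u w ∷ labels c p

  labels-++ʷ : {A : Set} (c : V G → V G → A) → ∀ {u v w} (p : Walk G u v) (q : Walk G v w) →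
               labels c (p ++ʷ q) ≡ labels c p ++ labels c q
  labels-++ʷ c []      q = refl
  labels-++ʷ c (e ∷ p) q = cong (_ ∷_) (labels-++ʷ c p q)

  labels-map : {A B : Set} (f : A → B) (c : V G → V G → A) → ∀ {u v} (p : Walk G u v) →
               labels (λ x y → f (c x y)) p ≡ map f (labels c p)
  labels-map f c []      = refl
  labels-map f c (e ∷ p) = cong (_ ∷_) (labels-map f c p)

  labels-cong : {A : Set} {c c' : V G → V G → A} → (∀ u v → E G u v → c u v ≡ c' u v) →
                ∀ {u v} (p : Walk G u v) → labels c p ≡ labels c' p
  labels-cong same []                = refl
  labels-cong same (_∷_ {u} {w} e p) = cong₂ _∷_ (same u w e) (labels-cong same p)

  length-subst : ∀ {u v v'} (eq : v ≡ v') (p : Walk G u v) → length (subst (Walk G u) eq p) ≡ length p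
  length-subst refl p = refl

  labels-subst : {A : Set} (c : V G → V G → A) → ∀ {u v v'} (eq : v ≡ v') (p : Walk G u v) →
                 labels c (subst (Walk G u) eq p) ≡ labels c p
  labels-subst c refl p = refl

  colours≡labels : ∀ {k} (c : V G → V G → Fin k) → ∀ {u v} (p : Walk G u v) →
                   colours c p ≡ labels c p
  colours≡labels c []      = refl
  colours≡labels c (e ∷ p) = cong (_ ∷_) (colours≡labels c p)

  module _ (sym-adj : ∀ u v → E G u v → E G v u) where
    reverseʷ : ∀ {u v} → Walk G u v → Walk G v u
    reverseʷ []      = []
    reverseʷ (e ∷ p) = reverseʷ p ++ʷ (sym-adj _ _ e ∷ [])

    length-reverseʷ : ∀ {u v} (p : Walk G u v) → length (reverseʷ p) ≡ length p
    length-reverseʷ []      = refl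
    length-reverseʷ (e ∷ p) = begin
      length (reverseʷ p ++ʷ _)  ≡⟨ length-++ʷ (reverseʷ p) _ ⟩
      length (reverseʷ p) + 1    ≡⟨ +-comm _ 1 ⟩
      suc (length (reverseʷ p))  ≡⟨ cong suc (length-reverseʷ p) ⟩
      suc (length p)             ∎
      where open ≡-Reasoning

    labels-reverseʷ : {A : Set} (c : V G → V G → A) → (∀ u v → E G u v → c u v ≡ c v u) →
                      ∀ {u v} (p : Walk G u v) → labels c (reverseʷ p) ≡ reverse (labels c p)
    labels-reverseʷ c c-sym []                  = refl
    labels-reverseʷ c c-sym (_∷_ {u} {w} e p)   = begin
      labels c (reverseʷ p ++ʷ _)            ≡⟨ labels-++ʷ c (reverseʷ p) _ ⟩
      labels c (reverseʷ p) ++ [ c w u ]     ≡⟨ cong₂ (λ xs x → xs ++ [ x ]) (labels-reverseʷ c c-sym p) (sym (c-sym u w e)) ⟩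
      reverse (labels c p) ++ [ c u w ]      ≡⟨ sym (unfold-reverse (c u w) (labels c p)) ⟩
      reverse (c u w ∷ labels c p)           ∎
      where open ≡-Reasoning

RainbowGeodesic : (G : Graph) {A : Set} → (V G → V G → A) → V G → V G → Set
RainbowGeodesic G c u v = Σ (Walk G u v) λ p → IsGeodesic p × Unique (labels c p)

module _ {G : Graph} {A : Set} where
  reverse-rainbow : (sym-adj : ∀ u v → E G u v → E G v u) (c : V G → V G → A) →
                    (∀ u v → E G u v → c u v ≡ c v u) →
                    ∀ {u v} → RainbowGeodesic G c v u → RainbowGeodesic G c u v
  reverse-rainbow sym-adj c c-sym (p , p-geo , p-rainbow) =
      reverseʷ sym-adj p , geodesic , subst Unique (sym (labels-reverseʷ sym-adj c c-sym p)) (Unique-reverse p-rainbow)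
    where
    geodesic : IsGeodesic (reverseʷ sym-adj p)
    geodesic q = begin
      length (reverseʷ sym-adj p)               ≡⟨ length-reverseʷ sym-adj p ⟩
      length p                                  ≤⟨ p-geo (reverseʷ sym-adj q) ⟩
      length (reverseʷ sym-adj q)               ≡⟨ length-reverseʷ sym-adj q ⟩
      length q                                  ∎
      where open ≤-Reasoning

  recolour-rainbow : {B : Set} (f : A → B) → (∀ {x y} → f x ≡ f y → x ≡ y) → (c : V G → V G → A) →
                     ∀ {u v} → RainbowGeodesic G c u v → RainbowGeodesic G (λ x y → f (c x y)) u v
  recolour-rainbow f f-inj c (p , p-geo , p-rainbow) =
    p , p-geo , subst Unique (sym (labels-map f c p)) (map⁺ f-inj p-rainbow)

module _ {G H : Graph} where
  liftˡ : (h : V H) → ∀ {g g'} → Walk G g g' → Walk (G □ H) (g , h) (g' , h)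
  liftˡ h []      = []
  liftˡ h (e ∷ p) = inj₁ (refl , e) ∷ liftˡ h p

  liftʳ : (g : V G) → ∀ {h h'} → Walk H h h' → Walk (G □ H) (g , h) (g , h')
  liftʳ g []      = []
  liftʳ g (e ∷ p) = inj₂ (refl , e) ∷ liftʳ g p

  length-liftˡ : (h : V H) → ∀ {g g'} (p : Walk G g g') → length (liftˡ h p) ≡ length p
  length-liftˡ h []      = refl
  length-liftˡ h (e ∷ p) = cong suc (length-liftˡ h p)

  length-liftʳ : (g : V G) → ∀ {h h'} (p : Walk H h h') → length (liftʳ g p) ≡ length p
  length-liftʳ g []      = refl
  length-liftʳ g (e ∷ p) = cong suc (length-liftʳ g p)

  labels-liftˡ : {A : Set} (c : V (G □ H) → V (G □ H) → A) (h : V H) → ∀ {g g'} (p : Walk G g g') →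
                 labels c (liftˡ h p) ≡ labels (λ x y → c (x , h) (y , h)) p
  labels-liftˡ c h []      = refl
  labels-liftˡ c h (e ∷ p) = cong (_ ∷_) (labels-liftˡ c h p)

  labels-liftʳ : {A : Set} (c : V (G □ H) → V (G □ H) → A) (g : V G) → ∀ {h h'} (p : Walk H h h') →
                 labels c (liftʳ g p) ≡ labels (λ x y → c (g , x) (g , y)) p
  labels-liftʳ c g []      = refl
  labels-liftʳ c g (e ∷ p) = cong (_ ∷_) (labels-liftʳ c g p)

  project : ∀ {g h g' h'} (P : Walk (G □ H) (g , h) (g' , h')) →
            Σ (Walk G g g') λ a → Σ (Walk H h h') λ b → length a + length b ≡ length P
  project []                        = [] , [] , refl
  project (inj₁ (refl , e) ∷ P) with project P
  ... | a , b , eq = e ∷ a , b , cong suc eq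
  project (inj₂ (refl , e) ∷ P) with project P
  ... | a , b , eq = a , e ∷ b , trans (+-suc (length a) (length b)) (cong suc eq)

  -- Distances add up in a product: a walk no longer than the sum of two
  -- geodesics of the factors between the projected endpoints is a geodesic.
  product-geodesic : ∀ {g h g' h'} {a : Walk G g g'} {b : Walk H h h'} (W : Walk (G □ H) (g , h) (g' , h')) →
                     IsGeodesic a → IsGeodesic b → length W ≤ length a + length b → IsGeodesic W
  product-geodesic {a = a} {b} W a-geo b-geo W≤ Q with project Q
  ... | a' , b' , eq = begin
    length W              ≤⟨ W≤ ⟩
    length a + length b   ≤⟨ +-mono-≤ (a-geo a') (b-geo b') ⟩
    length a' + length b' ≡⟨ eq ⟩
    length Q              ∎
    where open ≤-Reasoning

  -- Conversely the G-part of a geodesic of G □ H is a geodesic of G: a shorter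
  -- G-walk followed by the H-part would give a shorter walk of the product.
  factor-geodesic : ∀ {g h g' h'} {P : Walk (G □ H) (g , h) (g' , h')} (a : Walk G g g') (b : Walk H h h') →
                    IsGeodesic P → length P ≡ length a + length b → IsGeodesic a
  factor-geodesic {g} {h} {g'} {h'} {P} a b P-geo eq a' = +-cancelʳ-≤ (length b) (length a) (length a') (begin
    length a + length b                        ≡⟨ sym eq ⟩
    length P                                   ≤⟨ P-geo candidate ⟩
    length candidate                           ≡⟨ length-++ʷ (liftˡ h a') (liftʳ g' b) ⟩
    length (liftˡ h a') + length (liftʳ g' b)  ≡⟨ cong₂ _+_ (length-liftˡ h a') (length-liftʳ g' b) ⟩
    length a' + length b                       ∎)
    where
    open ≤-Reasoning
    candidate : Walk (G □ H) (g , h) (g' , h')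
    candidate = liftˡ h a' ++ʷ liftʳ g' b

cycle-symmetric : ∀ {n} (i j : Fin n) → CycleAdj n i j → CycleAdj n j i
cycle-symmetric i j (inj₁ e)                = inj₂ (inj₁ e)
cycle-symmetric i j (inj₂ (inj₁ e))         = inj₁ e
cycle-symmetric i j (inj₂ (inj₂ (inj₁ e)))  = inj₂ (inj₂ (inj₂ e))
cycle-symmetric i j (inj₂ (inj₂ (inj₂ e)))  = inj₂ (inj₂ (inj₁ e))

-- C_n has no loops once n ≥ 2 (the wrap-around clause makes 0 a loop of C_1).
cycle-loopless : ∀ {n} → 2 ≤ n → (i : Fin n) → ¬ CycleAdj n i i
cycle-loopless 2≤n i (inj₁ e)                       = 1+n≢n (sym e)
cycle-loopless 2≤n i (inj₂ (inj₁ e))                = 1+n≢n (sym e)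
cycle-loopless 2≤n i (inj₂ (inj₂ (inj₁ (i≡0 , e)))) = <-irrefl e (subst (λ x → suc x < _) (sym i≡0) 2≤n)
cycle-loopless 2≤n i (inj₂ (inj₂ (inj₂ (i≡0 , e)))) = <-irrefl e (subst (λ x → suc x < _) (sym i≡0) 2≤n)

cycle-distinct : ∀ {n} → 2 ≤ n → {i j : Fin n} → CycleAdj n i j → i ≢ j
cycle-distinct 2≤n {i} adj refl = cycle-loopless 2≤n i adj

C₂ : Graph
C₂ = Cycle 2

pattern 0₂ = F.zero
pattern 1₂ = F.suc F.zero

rungs : Fin 2 → Fin 2 → ℕ
rungs 0₂ 0₂ = 0
rungs 0₂ 1₂ = 1
rungs 1₂ 0₂ = 1
rungs 1₂ 1₂ = 0

rungs-self : ∀ x → rungs x x ≡ 0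
rungs-self 0₂ = refl
rungs-self 1₂ = refl

rungs-distinct : ∀ {x y} → x ≢ y → rungs x y ≡ 1
rungs-distinct {0₂} {0₂} x≢y = ⊥-elim (x≢y refl)
rungs-distinct {0₂} {1₂} x≢y = refl
rungs-distinct {1₂} {0₂} x≢y = refl
rungs-distinct {1₂} {1₂} x≢y = ⊥-elim (x≢y refl)

C₂-walk : ∀ x y → Walk C₂ x y
C₂-walk 0₂ 0₂ = []
C₂-walk 0₂ 1₂ = inj₁ refl ∷ []
C₂-walk 1₂ 0₂ = inj₂ (inj₁ refl) ∷ []
C₂-walk 1₂ 1₂ = []

length-C₂-walk : ∀ x y → length (C₂-walk x y) ≡ rungs x y
length-C₂-walk 0₂ 0₂ = refl
length-C₂-walk 0₂ 1₂ = refl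
length-C₂-walk 1₂ 0₂ = refl
length-C₂-walk 1₂ 1₂ = refl

rungs≤1 : ∀ x y → rungs x y ≤ 1
rungs≤1 0₂ 0₂ = z≤n
rungs≤1 0₂ 1₂ = s≤s z≤n
rungs≤1 1₂ 0₂ = s≤s z≤n
rungs≤1 1₂ 1₂ = z≤n

module TwoLayers {G : Graph} {A : Set} (ζ : V (G □ C₂) → V (G □ C₂) → A)
                 (ζ-sym : ∀ u v → E (G □ C₂) u v → ζ u v ≡ ζ v u) where

  layer : Fin 2 → V G → V G → A
  layer x g g' = ζ (g , x) (g' , x)

  rungColour : V G → A
  rungColour g = ζ (g , 0₂) (g , 1₂)

  rung-colour : ∀ g {x y} → CycleAdj 2 x y → ζ (g , x) (g , y) ≡ rungColour g
  rung-colour g {0₂} {1₂} e = refl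
  rung-colour g {1₂} {0₂} e = ζ-sym (g , 1₂) (g , 0₂) (inj₂ (refl , e))
  rung-colour g {0₂} {0₂} e = ⊥-elim (cycle-loopless ≤-refl 0₂ e)
  rung-colour g {1₂} {1₂} e = ⊥-elim (cycle-loopless ≤-refl 1₂ e)

  length-crossing : ∀ {g m g' x y} (w₁ : Walk G g m) (e : CycleAdj 2 x y) (w₂ : Walk G m g') →
                    length (liftˡ {H = C₂} x w₁ ++ʷ (inj₂ (refl , e) ∷ liftˡ y w₂)) ≡ suc (length (w₁ ++ʷ w₂))
  length-crossing {x = x} {y} w₁ e w₂ = begin
    length (liftˡ x w₁ ++ʷ _)                        ≡⟨ length-++ʷ (liftˡ x w₁) _ ⟩
    length (liftˡ x w₁) + suc (length (liftˡ y w₂))  ≡⟨ cong₂ (λ a b → a + suc b) (length-liftˡ x w₁) (length-liftˡ y w₂) ⟩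
    length w₁ + suc (length w₂)                      ≡⟨ +-suc (length w₁) (length w₂) ⟩
    suc (length w₁ + length w₂)                      ≡⟨ cong suc (sym (length-++ʷ w₁ w₂)) ⟩
    suc (length (w₁ ++ʷ w₂))                         ∎
    where open ≡-Reasoning

  data Layered : ∀ {g x g' y} → Walk (G □ C₂) (g , x) (g' , y) → Set where
    flat     : ∀ {g g' x} (w : Walk G g g') → Layered (liftˡ x w)
    crossing : ∀ {g m g' x y} (w₁ : Walk G g m) (e : CycleAdj 2 x y) (w₂ : Walk G m g') →
               Layered (liftˡ {H = C₂} x w₁ ++ʷ (inj₂ (refl , e) ∷ liftˡ y w₂))
    detour   : ∀ {g x g' y} {P : Walk (G □ C₂) (g , x) (g' , y)} (w : Walk G g g') →
               2 + length w ≤ length P → Layered P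

  layered : ∀ {g x g' y} (P : Walk (G □ C₂) (g , x) (g' , y)) → Layered P
  layered [] = flat []
  layered (inj₁ (refl , e) ∷ P) with layered P
  ... | flat w           = flat (e ∷ w)
  ... | crossing w₁ r w₂ = crossing (e ∷ w₁) r w₂
  ... | detour w bound   = detour (e ∷ w) (s≤s bound)
  layered (inj₂ (refl , r) ∷ P) with layered P
  ... | flat w           = crossing [] r w
  ... | crossing w₁ r' w₂ = detour (w₁ ++ʷ w₂) (s≤s (≤-reflexive (sym (length-crossing w₁ r' w₂))))
  ... | detour w bound   = detour w (m≤n⇒m≤1+n bound)

  record Decomposition {g x g' y} (P : Walk (G □ C₂) (g , x) (g' , y)) : Set where
    field
      mid           : V G
      before        : Walk G g mid
      after         : Walk G mid g'
      labels-split  : labels ζ P ≡ labels (layer x) before ++ replicate (rungs x y) (rungColour mid) ++ labels (layer y) after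
      base-geodesic : IsGeodesic (before ++ʷ after)

  flat-decomposition : ∀ {g g' x} (w : Walk G g g') → IsGeodesic (liftˡ {H = C₂} x w) → Decomposition (liftˡ x w)
  flat-decomposition {x = x} w geo = record
    { mid = _ ; before = w ; after = []
    ; labels-split = begin
        labels ζ (liftˡ x w)                                ≡⟨ labels-liftˡ ζ x w ⟩
        labels (layer x) w                                  ≡⟨ ++-identityʳ _ ⟨
        labels (layer x) w ++ []                            ≡⟨ cong (λ r → labels (layer x) w ++ replicate r _ ++ []) (rungs-self x) ⟨
        labels (layer x) w ++ replicate (rungs x x) _ ++ [] ∎
    ; base-geodesic = factor-geodesic (w ++ʷ []) [] geo (begin
        length (liftˡ x w)      ≡⟨ length-liftˡ x w ⟩
        length w                ≡⟨ +-identityʳ _ ⟨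
        length w + 0            ≡⟨ length-++ʷ w [] ⟨
        length (w ++ʷ [])       ≡⟨ +-identityʳ _ ⟨
        length (w ++ʷ []) + 0   ∎) }
    where open ≡-Reasoning

  crossing-decomposition : ∀ {g m g' x y} (w₁ : Walk G g m) (e : CycleAdj 2 x y) (w₂ : Walk G m g') →
                           let P = liftˡ {H = C₂} x w₁ ++ʷ (inj₂ (refl , e) ∷ liftˡ y w₂) in
                           IsGeodesic P → Decomposition P
  crossing-decomposition {m = m} {x = x} {y} w₁ e w₂ geo = record
    { mid = m ; before = w₁ ; after = w₂
    ; labels-split = begin
        labels ζ (liftˡ x w₁ ++ʷ _)                                          ≡⟨ labels-++ʷ ζ (liftˡ x w₁) _ ⟩
        labels ζ (liftˡ x w₁) ++ ζ (m , x) (m , y) ∷ labels ζ (liftˡ y w₂)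
          ≡⟨ cong₂ (λ as bs → as ++ ζ (m , x) (m , y) ∷ bs) (labels-liftˡ ζ x w₁) (labels-liftˡ ζ y w₂) ⟩
        labels (layer x) w₁ ++ ζ (m , x) (m , y) ∷ labels (layer y) w₂
          ≡⟨ cong (λ c → labels (layer x) w₁ ++ c ∷ labels (layer y) w₂) (rung-colour m e) ⟩
        labels (layer x) w₁ ++ replicate 1 (rungColour m) ++ labels (layer y) w₂
          ≡⟨ cong (λ r → labels (layer x) w₁ ++ replicate r (rungColour m) ++ labels (layer y) w₂)
                  (rungs-distinct (cycle-distinct ≤-refl e)) ⟨
        labels (layer x) w₁ ++ replicate (rungs x y) (rungColour m) ++ labels (layer y) w₂ ∎
    ; base-geodesic = factor-geodesic (w₁ ++ʷ w₂) (e ∷ []) geo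
        (trans (length-crossing w₁ e w₂) (+-comm 1 (length (w₁ ++ʷ w₂)))) }
    where open ≡-Reasoning

  -- A geodesic is never a detour: the projection followed by at most one rung is shorter.
  geodesic-no-detour : ∀ {g x g' y} {P : Walk (G □ C₂) (g , x) (g' , y)} → IsGeodesic P →
                       (w : Walk G g g') → ¬ (2 + length w ≤ length P)
  geodesic-no-detour {x = x} {g'} {y} {P} geo w too-long = <⇒≱ shortcut-shorter (geo shortcut)
    where
    shortcut : Walk (G □ C₂) _ (g' , y)
    shortcut = liftˡ x w ++ʷ liftʳ g' (C₂-walk x y)
    shortcut-shorter : length shortcut < length P
    shortcut-shorter = begin-strict
      length shortcut                                        ≡⟨ length-++ʷ (liftˡ x w) _ ⟩
      length (liftˡ x w) + length (liftʳ g' (C₂-walk x y))   ≡⟨ cong₂ _+_ (length-liftˡ x w) (trans (length-liftʳ g' _) (length-C₂-walk x y)) ⟩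
      length w + rungs x y                                   ≤⟨ +-monoʳ-≤ (length w) (rungs≤1 x y) ⟩
      length w + 1                                           <⟨ +-monoʳ-< (length w) (n<1+n 1) ⟩
      length w + 2                                           ≡⟨ +-comm (length w) 2 ⟩
      2 + length w                                           ≤⟨ too-long ⟩
      length P                                               ∎
      where open ≤-Reasoning

  decompose : ∀ {g x g' y} (P : Walk (G □ C₂) (g , x) (g' , y)) → IsGeodesic P → Decomposition P
  decompose P geo with layered P
  ... | flat w                = flat-decomposition w geo
  ... | crossing w₁ e w₂      = crossing-decomposition w₁ e w₂ geo
  ... | detour w too-long     = ⊥-elim (geodesic-no-detour geo w too-long)

interval : ℕ → ℕ → List ℕ
interval x zero    = []
interval x (suc d) = x ∷ interval (suc x) d

interval-++ : ∀ x d₁ d₂ → interval x (d₁ + d₂) ≡ interval x d₁ ++ interval (x + d₁) d₂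
interval-++ x zero     d₂ = cong (λ y → interval y d₂) (sym (+-identityʳ x))
interval-++ x (suc d₁) d₂ = cong (x ∷_) (trans (interval-++ (suc x) d₁ d₂) (cong (λ y → interval (suc x) d₁ ++ interval y d₂) (sym (+-suc x d₁))))

interval-lower : ∀ x d → All (x ≤_) (interval x d)
interval-lower x zero    = []
interval-lower x (suc d) = ≤-refl ∷ All.map (≤-trans (n≤1+n x)) (interval-lower (suc x) d)

interval-upper : ∀ x d → All (_< x + d) (interval x d)
interval-upper x zero    = []
interval-upper x (suc d) = ≤-trans (s≤s (m≤m+n x d)) (≤-reflexive (sym (+-suc x d)))
                         ∷ All.map (λ lt → ≤-trans lt (≤-reflexive (sym (+-suc x d)))) (interval-upper (suc x) d)

Unique-interval : ∀ x d → Unique (interval x d)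
Unique-interval x zero    = []
Unique-interval x (suc d) = All.map (λ x<y x≡y → <-irrefl x≡y x<y) (interval-lower (suc x) d) ∷ Unique-interval (suc x) d

Unique-intervals : ∀ x d y e → y + e ≤ x → Unique (interval x d ++ interval y e)
Unique-intervals x d y e y+e≤x = ++⁺ (Unique-interval x d) (Unique-interval y e) disjoint
  where
  disjoint : Disjoint (interval x d) (interval y e)
  disjoint (z∈xs , z∈ys) = <-irrefl refl (begin-strict
    _     <⟨ All.lookup (interval-upper y e) z∈ys ⟩
    y + e ≤⟨ y+e≤x ⟩
    x     ≤⟨ All.lookup (interval-lower x d) z∈xs ⟩
    _     ∎)
    where open ≤-Reasoning

module CycleGeometry (n : ℕ) where

  Cₙ : Graph
  Cₙ = Cycle n

  -- ℓ is at least the length of one of the two arcs of C_n between positions x and y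
  CycleBound : ℕ → ℕ → ℕ → Set
  CycleBound x y ℓ = ∣ x - y ∣ ≤ ℓ ⊎ n ≤ ∣ x - y ∣ + ℓ

  distance-suc : ∀ x → ∣ x - suc x ∣ ≡ 1
  distance-suc zero    = refl
  distance-suc (suc x) = distance-suc x

  distance-+ : ∀ {x y} e → y + e ≡ x → ∣ x - y ∣ ≡ e
  distance-+ {y = y} e refl = trans (∣-∣-comm (y + e) y) (∣m-m+n∣≡n y e)

  bound-step : ∀ x w y ℓ → ∣ x - w ∣ ≡ 1 → CycleBound w y ℓ → CycleBound x y (suc ℓ)
  bound-step x w y ℓ x~w (inj₁ near) = inj₁ (begin
    ∣ x - y ∣               ≤⟨ ∣-∣-triangle x w y ⟩
    ∣ x - w ∣ + ∣ w - y ∣   ≡⟨ cong (_+ ∣ w - y ∣) x~w ⟩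
    suc ∣ w - y ∣           ≤⟨ s≤s near ⟩
    suc ℓ                   ∎)
    where open ≤-Reasoning
  bound-step x w y ℓ x~w (inj₂ far) = inj₂ (begin
    n                           ≤⟨ far ⟩
    ∣ w - y ∣ + ℓ               ≤⟨ +-monoˡ-≤ ℓ (∣-∣-triangle w x y) ⟩
    ∣ w - x ∣ + ∣ x - y ∣ + ℓ   ≡⟨ cong (λ d → d + ∣ x - y ∣ + ℓ) (trans (∣-∣-comm w x) x~w) ⟩
    suc (∣ x - y ∣ + ℓ)         ≡⟨ sym (+-suc _ ℓ) ⟩
    ∣ x - y ∣ + suc ℓ           ∎)
    where open ≤-Reasoning

  bound-wrap-down : ∀ t y e ℓ → suc t ≡ n → y + e ≡ t → CycleBound t y ℓ → CycleBound 0 y (suc ℓ)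
  bound-wrap-down t y e ℓ refl refl (inj₁ near) = inj₂ (begin
    suc (y + e)  ≤⟨ s≤s (+-monoʳ-≤ y (subst (_≤ ℓ) (distance-+ {y = y} e refl) near)) ⟩
    suc (y + ℓ)  ≡⟨ sym (+-suc y ℓ) ⟩
    y + suc ℓ    ∎)
    where open ≤-Reasoning
  bound-wrap-down t y e ℓ refl refl (inj₂ far) = inj₁ (m≤n⇒m≤1+n (<⇒≤ (+-cancelʳ-< e y ℓ (begin-strict
    y + e              <⟨ n<1+n (y + e) ⟩
    suc (y + e)        ≤⟨ far ⟩
    ∣ y + e - y ∣ + ℓ  ≡⟨ cong (_+ ℓ) (distance-+ {y = y} e refl) ⟩
    e + ℓ              ≡⟨ +-comm e ℓ ⟩
    ℓ + e              ∎))))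
    where open ≤-Reasoning

  bound-wrap-up : ∀ t y e ℓ → suc t ≡ n → y + e ≡ t → CycleBound 0 y ℓ → CycleBound t y (suc ℓ)
  bound-wrap-up t y e ℓ refl refl (inj₁ near) = inj₂ (begin
    suc (y + e)          ≡⟨ cong suc (+-comm y e) ⟩
    suc (e + y)          ≤⟨ s≤s (+-monoʳ-≤ e near) ⟩
    suc (e + ℓ)          ≡⟨ sym (+-suc e ℓ) ⟩
    e + suc ℓ            ≡⟨ cong (_+ suc ℓ) (sym (distance-+ {y = y} e refl)) ⟩
    ∣ y + e - y ∣ + suc ℓ ∎)
    where open ≤-Reasoning
  bound-wrap-up t y e ℓ refl refl (inj₂ far) = inj₁ (begin
    ∣ y + e - y ∣  ≡⟨ distance-+ {y = y} e refl ⟩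
    e              ≤⟨ m≤n⇒m≤1+n (<⇒≤ (+-cancelˡ-< y e ℓ far)) ⟩
    suc ℓ          ∎)
    where open ≤-Reasoning

  below-last : ∀ {t} → suc t ≡ n → (v : Fin n) → Σ ℕ λ e → toℕ v + e ≡ t
  below-last refl v = m≤n⇒∃[o]m+o≡n (≤-pred (toℕ<n v))

  walk-bound : ∀ {u v} (p : Walk Cₙ u v) → CycleBound (toℕ u) (toℕ v) (length p)
  walk-bound {u} [] = inj₁ (≤-reflexive (∣n-n∣≡0 (toℕ u)))
  walk-bound {u} {v} (_∷_ {w = w} (inj₁ up) p) =
    bound-step (toℕ u) (toℕ w) (toℕ v) _ (trans (cong (∣ toℕ u -_∣) up) (distance-suc (toℕ u))) (walk-bound p)
  walk-bound {u} {v} (_∷_ {w = w} (inj₂ (inj₁ down)) p) =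
    bound-step (toℕ u) (toℕ w) (toℕ v) _ (trans (cong (∣_- toℕ w ∣) down) (distance-+ 1 (+-comm (toℕ w) 1))) (walk-bound p)
  walk-bound {u} {v} (_∷_ {w = w} (inj₂ (inj₂ (inj₁ (u≡0 , wraps)))) p) with below-last wraps v
  ... | e , v+e≡w = subst (λ x → CycleBound x (toℕ v) _) (sym u≡0)
                          (bound-wrap-down (toℕ w) (toℕ v) e _ wraps v+e≡w (walk-bound p))
  walk-bound {u} {v} (_∷_ {w = w} (inj₂ (inj₂ (inj₂ (w≡0 , wraps)))) p) with below-last wraps v
  ... | e , v+e≡u = bound-wrap-up (toℕ u) (toℕ v) e _ wraps v+e≡u
                          (subst (λ x → CycleBound x (toℕ v) (length p)) w≡0 (walk-bound p))

  cycle-geodesic : ∀ {u v} (w : Walk Cₙ u v) → length w ≤ ∣ toℕ u - toℕ v ∣ →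
                   length w + ∣ toℕ u - toℕ v ∣ ≤ n → IsGeodesic w
  cycle-geodesic {u} {v} w ≤arc ≤coarc p with walk-bound p
  ... | inj₁ near = ≤-trans ≤arc near
  ... | inj₂ far  = +-cancelʳ-≤ ∣ toℕ u - toℕ v ∣ (length w) (length p)
                      (≤-trans ≤coarc (≤-trans far (≤-reflexive (+-comm ∣ toℕ u - toℕ v ∣ (length p)))))

  ascend : ∀ d {u v : Fin n} → toℕ v ≡ toℕ u + d → Walk Cₙ u v
  ascend zero    {u}     eq = subst (Walk Cₙ u) (toℕ-injective (sym (trans eq (+-identityʳ _)))) []
  ascend (suc d) {u} {v} eq = inj₁ (toℕ-fromℕ< next) ∷ ascend d (trans eq (shift-start next))
    where
    next : suc (toℕ u) < n
    next = ≤-trans (s≤s (≤-trans (s≤s (m≤m+n (toℕ u) d)) (≤-reflexive (sym (trans eq (+-suc (toℕ u) d)))))) (toℕ<n v)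
    shift-start : (lt : suc (toℕ u) < n) → toℕ u + suc d ≡ toℕ (fromℕ< lt) + d
    shift-start lt = trans (+-suc (toℕ u) d) (cong (_+ d) (sym (toℕ-fromℕ< lt)))

  length-ascend : ∀ d {u v} (eq : toℕ v ≡ toℕ u + d) → length (ascend d eq) ≡ d
  length-ascend zero    eq = length-subst _ []
  length-ascend (suc d) eq = cong suc (length-ascend d _)

  labels-ascend : {A : Set} (c : Fin n → Fin n → A) (f : ℕ → A) →
                  (∀ {i j} → toℕ j ≡ suc (toℕ i) → c i j ≡ f (toℕ i)) →
                  ∀ d {u v} (eq : toℕ v ≡ toℕ u + d) → labels c (ascend d eq) ≡ map f (interval (toℕ u) d)
  labels-ascend c f step zero    eq = labels-subst c _ []
  labels-ascend c f step (suc d) eq = cong₂ _∷_ (step (toℕ-fromℕ< _))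
    (trans (labels-ascend c f step d _) (cong (λ x → map f (interval x d)) (toℕ-fromℕ< _)))

specials : {A : Set} → List (Maybe A) → ℕ
specials []            = 0
specials (just _ ∷ l)  = specials l
specials (nothing ∷ l) = suc (specials l)

module _ {A B : Set} (f : A → B) where
  specials-map : (l : List (Maybe A)) → specials (map (Maybe.map f) l) ≡ specials l
  specials-map []            = refl
  specials-map (just _ ∷ l)  = specials-map l
  specials-map (nothing ∷ l) = cong suc (specials-map l)

  Unique-catMaybes : (l : List (Maybe A)) → Unique (catMaybes (map (Maybe.map f) l)) → Unique (catMaybes l)
  Unique-catMaybes l distinct = map⁻ (subst Unique (sym (map-catMaybes f l)) distinct)

module _ {A : Set} where
  catMaybes-just : (xs : List A) → catMaybes (map just xs) ≡ xs
  catMaybes-just []       = refl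
  catMaybes-just (x ∷ xs) = cong (x ∷_) (catMaybes-just xs)

  specials-just : (xs : List A) → specials (map just xs) ≡ 0
  specials-just []       = refl
  specials-just (_ ∷ xs) = specials-just xs

  specials-just-nothing-just : (xs ys : List A) → specials (map just xs ++ nothing ∷ map just ys) ≡ 1
  specials-just-nothing-just []       ys = cong suc (specials-just ys)
  specials-just-nothing-just (_ ∷ xs) ys = specials-just-nothing-just xs ys

  catMaybes-just-nothing-just : (xs ys : List A) → catMaybes (map just xs ++ nothing ∷ map just ys) ≡ xs ++ ys
  catMaybes-just-nothing-just xs ys = trans (catMaybes-++ (map just xs) _) (cong₂ _++_ (catMaybes-just xs) (catMaybes-just ys))

-- The cycle C_n with n = a + b + 2 is split into side A (positions 0 … a, a path
-- with a edges) and side B (positions a+1 … a+1+b, a path with b edges), joined by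
-- the middle edge {a, a+1} and the wrap-around edge {a+1+b, 0}. The edges of each
-- side are coloured 0, 1, 2, … along the side; the two joining edges are left
-- unlabelled. For b ≤ a ≤ b + 2 this uses a colours, and every pair of vertices
-- is joined by a geodesic with distinct colours that uses exactly as many
-- unlabelled edges as the vertices lie on different sides.
module TwoArcColouring (a b : ℕ) (b≤a : b ≤ a) (a≤2+b : a ≤ 2 + b) where

  open CycleGeometry (2 + (a + b)) public

  n : ℕ
  n = 2 + (a + b)

  side : Fin n → Fin 2
  side i with toℕ i ≤? a
  ... | yes _ = 0₂
  ... | no _  = 1₂

  side-A : ∀ {i} → toℕ i ≤ a → side i ≡ 0₂
  side-A {i} i≤a with toℕ i ≤? a
  ... | yes _ = refl
  ... | no i≰a = ⊥-elim (i≰a i≤a)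

  side-B : ∀ {i} s → toℕ i ≡ suc a + s → side i ≡ 1₂
  side-B {i} s i≡ with toℕ i ≤? a
  ... | no _     = refl
  ... | yes i≤a = ⊥-elim (<⇒≱ (≤-trans (s≤s (m≤m+n a s)) (≤-reflexive (sym i≡))) i≤a)

  sideB-bound : (j : Fin n) (s : ℕ) → toℕ j ≡ suc a + s → s ≤ b
  sideB-bound j s j≡ = +-cancelˡ-≤ (suc a) s b (≤-pred (subst (_< n) j≡ (toℕ<n j)))

  edgeColour : ℕ → Maybe (Fin a)
  edgeColour t with t <? a
  ... | yes t<a = just (fromℕ< t<a)
  ... | no _ with t ∸ suc a <? b | a <? t
  ...   | yes s<b | yes _ = just (fromℕ< (<-≤-trans s<b b≤a))
  ...   | _       | _     = nothing

  -- the colour as a number: t on side A, nothing on the middle edge, t - (a+1) on side B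
  colourIndex : ℕ → Maybe ℕ
  colourIndex t = Maybe.map toℕ (edgeColour t)

  colourIndex-A : ∀ t → t < a → colourIndex t ≡ just t
  colourIndex-A t t<a with t <? a
  ... | yes _   = cong just (toℕ-fromℕ< _)
  ... | no t≮a = ⊥-elim (t≮a t<a)

  colourIndex-middle : colourIndex a ≡ nothing
  colourIndex-middle with a <? a
  ... | yes a<a = ⊥-elim (<-irrefl refl a<a)
  ... | no _ with a ∸ suc a <? b | a <? a
  ...   | yes _ | yes a<a = ⊥-elim (<-irrefl refl a<a)
  ...   | yes _ | no _    = refl
  ...   | no _  | _       = refl

  colourIndex-B : ∀ s → s < b → colourIndex (suc a + s) ≡ just s
  colourIndex-B s s<b with suc a + s <? a
  ... | yes t<a = ⊥-elim (<⇒≱ t<a (≤-trans (n≤1+n a) (m≤m+n (suc a) s)))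
  ... | no _ with suc a + s ∸ suc a <? b | a <? suc a + s
  ...   | yes _ | yes _   = cong just (trans (toℕ-fromℕ< _) (m+n∸m≡n (suc a) s))
  ...   | yes _ | no a≮t  = ⊥-elim (a≮t (s≤s (m≤m+n a s)))
  ...   | no s≮b | _      = ⊥-elim (s≮b (subst (_< b) (sym (m+n∸m≡n (suc a) s)) s<b))

  colourIndices-A : ∀ x d → x + d ≤ a → map colourIndex (interval x d) ≡ map just (interval x d)
  colourIndices-A x zero    _   = refl
  colourIndices-A x (suc d) x+d≤a =
    cong₂ _∷_ (colourIndex-A x (≤-trans (s≤s (m≤m+n x d)) (≤-trans (≤-reflexive (sym (+-suc x d))) x+d≤a)))
              (colourIndices-A (suc x) d (≤-trans (≤-reflexive (sym (+-suc x d))) x+d≤a))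

  colourIndices-B : ∀ s d → s + d ≤ b → map colourIndex (interval (suc a + s) d) ≡ map just (interval s d)
  colourIndices-B s zero    _   = refl
  colourIndices-B s (suc d) s+d≤b =
    cong₂ _∷_ (colourIndex-B s (≤-trans (s≤s (m≤m+n s d)) (≤-trans (≤-reflexive (sym (+-suc s d))) s+d≤b)))
              (trans (cong (λ x → map colourIndex (interval x d)) (sym (+-suc (suc a) s)))
                     (colourIndices-B (suc s) d (≤-trans (≤-reflexive (sym (+-suc s d))) s+d≤b)))

  -- the colouring of C_n: the edge {t, t+1} gets edgeColour t, the wrap-around edge none
  κ : Fin n → Fin n → Maybe (Fin a)
  κ i j with suc (toℕ i) ≟ toℕ j | suc (toℕ j) ≟ toℕ i
  ... | yes _ | _     = edgeColour (toℕ i)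
  ... | no _  | yes _ = edgeColour (toℕ j)
  ... | no _  | no _  = nothing

  κ-symmetric : ∀ i j → κ i j ≡ κ j i
  κ-symmetric i j with suc (toℕ i) ≟ toℕ j | suc (toℕ j) ≟ toℕ i
  ... | yes up | yes down = ⊥-elim (<-irrefl (sym (trans (cong suc up) down)) (n≤1+n (suc (toℕ i))))
  ... | yes _  | no _     = refl
  ... | no _   | yes _    = refl
  ... | no _   | no _     = refl

  κ-up : ∀ {i j} → toℕ j ≡ suc (toℕ i) → Maybe.map toℕ (κ i j) ≡ colourIndex (toℕ i)
  κ-up {i} {j} up with suc (toℕ i) ≟ toℕ j
  ... | yes _  = refl
  ... | no ¬up = ⊥-elim (¬up (sym up))

  last : Fin n
  last = fromℕ (suc (a + b))

  wrap-edge : CycleAdj n last F.zero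
  wrap-edge = inj₂ (inj₂ (inj₂ (refl , cong suc (toℕ-fromℕ (suc (a + b))))))

  -- (for n = 2 the wrap-around edge is the middle edge {0, 1}, again unlabelled)
  κ-wrap : κ last F.zero ≡ nothing
  κ-wrap with suc (toℕ last) ≟ 0 | 1 ≟ toℕ last
  ... | yes ()   | _
  ... | no _     | no _ = refl
  ... | no _     | yes 1≡last = subst (λ t → edgeColour t ≡ nothing) a≡0 (unlabelled colourIndex-middle)
    where
    a≡0 : a ≡ 0
    a≡0 = m+n≡0⇒m≡0 a (suc-injective (trans (sym (toℕ-fromℕ (suc (a + b)))) (sym 1≡last)))
    unlabelled : ∀ {c : Maybe (Fin a)} → Maybe.map toℕ c ≡ nothing → c ≡ nothing
    unlabelled {nothing} _ = refl

  colourIndices : ∀ {i j} → Walk Cₙ i j → List (Maybe ℕ)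
  colourIndices = labels (λ u v → Maybe.map toℕ (κ u v))

  colourIndices-ascend : ∀ d {u v} (eq : toℕ v ≡ toℕ u + d) →
                         colourIndices (ascend d eq) ≡ map colourIndex (interval (toℕ u) d)
  colourIndices-ascend = labels-ascend _ colourIndex κ-up

  record Arc (i j : Fin n) : Set where
    field
      walk      : Walk Cₙ i j
      geodesic  : IsGeodesic walk
      rainbow   : Unique (catMaybes (labels κ walk))
      crossings : specials (labels κ walk) ≡ rungs (side i) (side j)

  plainArc : ∀ {i j} (w : Walk Cₙ i j) → IsGeodesic w → ∀ {xs} → colourIndices w ≡ map just xs →
             Unique xs → rungs (side i) (side j) ≡ 0 → Arc i j
  plainArc w geo {xs} shape distinct no-rung = record
    { walk = w ; geodesic = geo
    ; rainbow = Unique-catMaybes toℕ (labels κ w) (subst Unique (sym (trans (cong catMaybes indices) (catMaybes-just xs))) distinct)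
    ; crossings = trans (sym (specials-map toℕ (labels κ w))) (trans (cong specials indices) (trans (specials-just xs) (sym no-rung))) }
    where
    indices : map (Maybe.map toℕ) (labels κ w) ≡ map just xs
    indices = trans (sym (labels-map (Maybe.map toℕ) κ w)) shape

  crossingArc : ∀ {i j} (w : Walk Cₙ i j) → IsGeodesic w → ∀ {xs ys} →
                colourIndices w ≡ map just xs ++ nothing ∷ map just ys →
                Unique (xs ++ ys) → rungs (side i) (side j) ≡ 1 → Arc i j
  crossingArc w geo {xs} {ys} shape distinct one-rung = record
    { walk = w ; geodesic = geo
    ; rainbow = Unique-catMaybes toℕ (labels κ w)
                  (subst Unique (sym (trans (cong catMaybes indices) (catMaybes-just-nothing-just xs ys))) distinct)
    ; crossings = trans (sym (specials-map toℕ (labels κ w))) (trans (cong specials indices) (trans (specials-just-nothing-just xs ys) (sym one-rung))) }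
    where
    indices : map (Maybe.map toℕ) (labels κ w) ≡ map just xs ++ nothing ∷ map just ys
    indices = trans (sym (labels-map (Maybe.map toℕ) κ w)) shape

  -- An ascending walk of length at most a is a geodesic, since 2a ≤ n.
  short-geodesic : ∀ d {u v} (eq : toℕ v ≡ toℕ u + d) → d ≤ a → IsGeodesic (ascend d eq)
  short-geodesic d {u} {v} eq d≤a = cycle-geodesic (ascend d eq) (≤-reflexive (trans (length-ascend d eq) (sym dist))) (begin
    length (ascend d eq) + ∣ toℕ u - toℕ v ∣  ≡⟨ cong₂ _+_ (length-ascend d eq) dist ⟩
    d + d                                     ≤⟨ +-mono-≤ d≤a d≤a ⟩
    a + a                                     ≤⟨ +-monoʳ-≤ a a≤2+b ⟩
    a + (2 + b)                               ≡⟨ +-suc a (suc b) ⟩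
    suc (a + suc b)                           ≡⟨ cong suc (+-suc a b) ⟩
    n                                         ∎)
    where
    open ≤-Reasoning
    dist : ∣ toℕ u - toℕ v ∣ ≡ d
    dist = trans (cong (∣ toℕ u -_∣) eq) (∣m-m+n∣≡n (toℕ u) d)

  sideA-arc : ∀ {i j} d → (eq : toℕ j ≡ toℕ i + d) → toℕ j ≤ a → Arc i j
  sideA-arc {i} {j} d eq j≤a = plainArc (ascend d eq) (short-geodesic d eq (≤-trans (m≤n+m d (toℕ i)) i+d≤a))
    (trans (colourIndices-ascend d eq) (colourIndices-A (toℕ i) d i+d≤a)) (Unique-interval (toℕ i) d)
    (cong₂ rungs (side-A (≤-trans (m≤m+n (toℕ i) d) i+d≤a)) (side-A j≤a))
    where
    i+d≤a : toℕ i + d ≤ a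
    i+d≤a = ≤-trans (≤-reflexive (sym eq)) j≤a

  sideB-arc : ∀ {i j} s d → toℕ i ≡ suc a + s → (eq : toℕ j ≡ toℕ i + d) → Arc i j
  sideB-arc {i} {j} s d i≡ eq = plainArc (ascend d eq) (short-geodesic d eq (≤-trans (m≤n+m d s) (≤-trans s+d≤b b≤a)))
    (trans (colourIndices-ascend d eq) (trans (cong (λ x → map colourIndex (interval x d)) i≡) (colourIndices-B s d s+d≤b)))
    (Unique-interval s d)
    (cong₂ rungs (side-B s i≡) (side-B (s + d) j≡))
    where
    j≡ : toℕ j ≡ suc a + (s + d)
    j≡ = trans eq (trans (cong (_+ d) i≡) (+-assoc (suc a) s d))
    s+d≤b : s + d ≤ b
    s+d≤b = sideB-bound j (s + d) j≡

  -- From side A to side B through the middle edge, when the colours of the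
  -- side-B part (0 … e-1) stay below those of the side-A part (x … a-1).
  middle-arc : ∀ {i j} d e → toℕ i + d ≡ a → toℕ j ≡ suc a + e → e < toℕ i → Arc i j
  middle-arc {i} {j} d e i+d≡a j≡ e<i = crossingArc (ascend (d + suc e) eq)
    (short-geodesic (d + suc e) eq (≤-trans (+-monoʳ-≤ d e<i) (≤-reflexive (trans (+-comm d x) i+d≡a))))
    shape (Unique-intervals x d 0 e (<⇒≤ e<i))
    (cong₂ rungs (side-A (≤-trans (m≤m+n x d) (≤-reflexive i+d≡a))) (side-B e j≡))
    where
    x = toℕ i
    eq : toℕ j ≡ x + (d + suc e)
    eq = trans j≡ (trans (cong (λ y → suc y + e) (sym i+d≡a)) (shift x d e))
      where shift : ∀ x d e → suc (x + d) + e ≡ x + (d + suc e)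
            shift = solve-∀
    shape : colourIndices (ascend (d + suc e) eq) ≡ map just (interval x d) ++ nothing ∷ map just (interval 0 e)
    shape = begin
      colourIndices (ascend (d + suc e) eq)                                    ≡⟨ colourIndices-ascend (d + suc e) eq ⟩
      map colourIndex (interval x (d + suc e))                                 ≡⟨ cong (map colourIndex) (interval-++ x d (suc e)) ⟩
      map colourIndex (interval x d ++ interval (x + d) (suc e))               ≡⟨ map-++ colourIndex (interval x d) _ ⟩
      map colourIndex (interval x d) ++ map colourIndex (interval (x + d) (suc e))
        ≡⟨ cong (λ y → map colourIndex (interval x d) ++ map colourIndex (interval y (suc e))) i+d≡a ⟩
      map colourIndex (interval x d) ++ colourIndex a ∷ map colourIndex (interval (suc a) e)
        ≡⟨ cong (λ y → map colourIndex (interval x d) ++ colourIndex a ∷ map colourIndex (interval y e)) (+-identityʳ (suc a)) ⟨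
      map colourIndex (interval x d) ++ colourIndex a ∷ map colourIndex (interval (suc a + 0) e)
        ≡⟨ cong₂ _++_ (colourIndices-A x d (≤-reflexive i+d≡a))
                 (cong₂ _∷_ colourIndex-middle (colourIndices-B 0 e (sideB-bound j e j≡))) ⟩
      map just (interval x d) ++ nothing ∷ map just (interval 0 e)             ∎
      where open ≡-Reasoning

  wrap-walk : ∀ {i j} c → toℕ last ≡ toℕ j + c → Walk Cₙ j i
  wrap-walk {i} c to-last = ascend c to-last ++ʷ (wrap-edge ∷ ascend (toℕ i) refl)

  length-wrap-walk : ∀ {i j} c (to-last : toℕ last ≡ toℕ j + c) → length (wrap-walk {i} c to-last) ≡ c + suc (toℕ i)
  length-wrap-walk {i} c to-last = trans (length-++ʷ (ascend c to-last) _)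
    (cong₂ (λ p q → p + suc q) (length-ascend c to-last) (length-ascend (toℕ i) refl))

  colourIndices-wrap-walk : ∀ {i j} c (to-last : toℕ last ≡ toℕ j + c) →
    colourIndices (wrap-walk {i} c to-last) ≡ map colourIndex (interval (toℕ j) c) ++ nothing ∷ map colourIndex (interval 0 (toℕ i))
  colourIndices-wrap-walk {i} c to-last = trans (labels-++ʷ _ (ascend c to-last) _)
    (cong₂ _++_ (colourIndices-ascend c to-last)
      (cong₂ _∷_ (cong (Maybe.map toℕ) κ-wrap) (colourIndices-ascend (toℕ i) refl)))

  -- From side B back to side A through the wrap-around edge, when the side-A
  -- colours (0 … x-1) stay below the side-B colours (e … b-1), e = x + f.
  wrap-arc : ∀ {i j} f c → toℕ j ≡ suc a + (toℕ i + f) → toℕ i + f + c ≡ b → Arc j i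
  wrap-arc {i} {j} f c j≡ e+c≡b = crossingArc (wrap-walk c to-last) geodesic shape
    (Unique-intervals (x + f) c 0 x (m≤m+n x f)) (cong₂ rungs (side-B (x + f) j≡) (side-A x≤a))
    where
    x = toℕ i
    x≤a : x ≤ a
    x≤a = ≤-trans (m≤m+n x f) (≤-trans (m≤m+n (x + f) c) (≤-trans (≤-reflexive e+c≡b) b≤a))
    to-last : toℕ last ≡ toℕ j + c
    to-last = trans (toℕ-fromℕ (suc (a + b))) (sym (trans (cong (_+ c) j≡)
                (trans (+-assoc (suc a) (x + f) c) (cong (λ y → suc (a + y)) e+c≡b))))

    shape : colourIndices (wrap-walk c to-last) ≡ map just (interval (x + f) c) ++ nothing ∷ map just (interval 0 x)
    shape = trans (colourIndices-wrap-walk c to-last) (cong₂ (λ p q → p ++ nothing ∷ q)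
      (trans (cong (λ y → map colourIndex (interval y c)) j≡) (colourIndices-B (x + f) c (≤-reflexive e+c≡b)))
      (colourIndices-A 0 x x≤a))

    distance : ∣ toℕ j - x ∣ ≡ suc a + f
    distance = distance-+ (suc a + f) (trans (shift x a f) (sym j≡))
      where shift : ∀ x a f → x + (suc a + f) ≡ suc a + (x + f)
            shift = solve-∀

    geodesic : IsGeodesic (wrap-walk c to-last)
    geodesic = cycle-geodesic _
      (begin
        length (wrap-walk c to-last) ≡⟨ length-wrap-walk c to-last ⟩
        c + suc x                    ≡⟨ +-suc c x ⟩
        suc (c + x)                  ≡⟨ cong suc (+-comm c x) ⟩
        suc (x + c)                  ≤⟨ s≤s (+-monoˡ-≤ c (m≤m+n x f)) ⟩
        suc (x + f + c)              ≡⟨ cong suc e+c≡b ⟩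
        suc b                        ≤⟨ s≤s (≤-trans b≤a (m≤m+n a f)) ⟩
        suc a + f                    ≡⟨ distance ⟨
        ∣ toℕ j - x ∣                ∎)
      (≤-reflexive (begin-equality
        length (wrap-walk c to-last) + ∣ toℕ j - x ∣  ≡⟨ cong₂ _+_ (length-wrap-walk c to-last) distance ⟩
        c + suc x + (suc a + f)                       ≡⟨ around x f c a ⟩
        2 + (a + (x + f + c))                         ≡⟨ cong (λ y → 2 + (a + y)) e+c≡b ⟩
        n                                             ∎))
      where
      open ≤-Reasoning
      around : ∀ x f c a → c + suc x + (suc a + f) ≡ 2 + (a + (x + f + c))
      around = solve-∀

  across : ∀ {i j} d e → toℕ i + d ≡ a → toℕ j ≡ suc a + e → Arc i j ⊎ Arc j i
  across {i} {j} d e i+d≡a j≡ with e <? toℕ i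
  ... | yes e<i = inj₁ (middle-arc d e i+d≡a j≡ e<i)
  ... | no e≮i with m≤n⇒∃[o]m+o≡n (≮⇒≥ e≮i) | m≤n⇒∃[o]m+o≡n (sideB-bound j e j≡)
  ...   | f , i+f≡e | c , e+c≡b =
    inj₂ (wrap-arc f c (trans j≡ (cong (suc a +_) (sym i+f≡e))) (trans (cong (_+ c) i+f≡e) e+c≡b))

  arc-ordered : (i j : Fin n) → toℕ i ≤ toℕ j → Arc i j ⊎ Arc j i
  arc-ordered i j i≤j with m≤n⇒∃[o]m+o≡n i≤j | toℕ j ≤? a | suc a ≤? toℕ i
  ... | d , i+d≡j | yes j≤a | _        = inj₁ (sideA-arc d (sym i+d≡j) j≤a)
  ... | d , i+d≡j | no _    | yes a<i  = inj₁ (sideB-arc s d (sym a+s≡i) (sym i+d≡j))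
    where
    s = proj₁ (m≤n⇒∃[o]m+o≡n a<i)
    a+s≡i = proj₂ (m≤n⇒∃[o]m+o≡n a<i)
  ... | _         | no j≰a  | no a≮i   =
    across (proj₁ i-below) (proj₁ j-above) (proj₂ i-below) (sym (proj₂ j-above))
    where
    i-below = m≤n⇒∃[o]m+o≡n (≤-pred (≰⇒> a≮i))
    j-above = m≤n⇒∃[o]m+o≡n (≰⇒> j≰a)

  arc : (i j : Fin n) → Arc i j ⊎ Arc j i
  arc i j with ≤-total (toℕ i) (toℕ j)
  ... | inj₁ i≤j = arc-ordered i j i≤j
  ... | inj₂ j≤i = swap (arc-ordered j i j≤i)

module LiftedColouring {Γ : Graph} (_≟Γ_ : DecidableEquality (V Γ)) (Γ-sym : ∀ u v → E Γ u v → E Γ v u)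
            (a b : ℕ) (b≤a : b ≤ a) (a≤2+b : a ≤ 2 + b)
            {k : ℕ} (ζ : V (Γ □ C₂) → V (Γ □ C₂) → Fin k) (ζ-strong : IsStrongRainbowColouring (Γ □ C₂) k ζ) where

  open TwoArcColouring a b b≤a a≤2+b
  open TwoLayers ζ (proj₁ ζ-strong)

  ΓCₙ : Graph
  ΓCₙ = Γ □ Cₙ

  ΓCₙ-sym : ∀ u v → E ΓCₙ u v → E ΓCₙ v u
  ΓCₙ-sym (g , i) (g' , j) (inj₁ (i≡j , adj)) = inj₁ (sym i≡j , Γ-sym g g' adj)
  ΓCₙ-sym (g , i) (g' , j) (inj₂ (g≡g' , adj)) = inj₂ (sym g≡g' , cycle-symmetric i j adj)

  prism-rainbow : ∀ u v → RainbowGeodesic (Γ □ C₂) ζ u v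
  prism-rainbow u v with ≡-dec _≟Γ_ F._≟_ u v
  ... | yes refl = [] , (λ _ → z≤n) , []
  ... | no u≢v with proj₂ ζ-strong u v u≢v
  ...   | p , p-geo , p-rainbow = p , p-geo , subst Unique (colours≡labels ζ p) p-rainbow

  interpret : V Γ → Maybe (Fin a) → Fin a ⊎ Fin k
  interpret g (just t) = inj₁ t
  interpret g nothing  = inj₂ (rungColour g)

  colour : V ΓCₙ → V ΓCₙ → Fin a ⊎ Fin k
  colour (g , i) (g' , j) with i F.≟ j
  ... | yes _ = inj₂ (layer (side i) g g')
  ... | no _  = interpret g (κ i j)

  colour-layer : ∀ g g' i → colour (g , i) (g' , i) ≡ inj₂ (layer (side i) g g')
  colour-layer g g' i with i F.≟ i
  ... | yes _  = refl
  ... | no i≢i = ⊥-elim (i≢i refl)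

  colour-fibre : ∀ g {i j} → i ≢ j → colour (g , i) (g , j) ≡ interpret g (κ i j)
  colour-fibre g {i} {j} i≢j with i F.≟ j
  ... | yes i≡j = ⊥-elim (i≢j i≡j)
  ... | no _    = refl

  -- C_n has no loops, so the edges of a copy {g} × C_n join distinct cycle vertices
  n≥2 : 2 ≤ n
  n≥2 = s≤s (s≤s z≤n)

  colour-symmetric : ∀ u v → E ΓCₙ u v → colour u v ≡ colour v u
  colour-symmetric (g , i) (g' , .i) (inj₁ (refl , adj)) =
    trans (colour-layer g g' i) (trans (cong inj₂ (proj₁ ζ-strong _ _ (inj₁ (refl , adj)))) (sym (colour-layer g' g i)))
  colour-symmetric (g , i) (.g , j) (inj₂ (refl , adj)) =
    trans (colour-fibre g (cycle-distinct n≥2 adj))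
          (trans (cong (interpret g) (κ-symmetric i j)) (sym (colour-fibre g (cycle-distinct n≥2 (cycle-symmetric i j adj)))))

  labels-layer : ∀ i {g g'} (w : Walk Γ g g') → labels colour (liftˡ {H = Cₙ} i w) ≡ map inj₂ (labels (layer (side i)) w)
  labels-layer i w = trans (labels-liftˡ colour i w)
    (trans (labels-cong (λ g g' _ → colour-layer g g' i) w) (labels-map inj₂ (layer (side i)) w))

  labels-fibre : ∀ g {i j} (w : Walk Cₙ i j) → labels colour (liftʳ {G = Γ} g w) ≡ map (interpret g) (labels κ w)
  labels-fibre g w = trans (labels-liftʳ colour g w)
    (trans (labels-cong (λ i j adj → colour-fibre g (cycle-distinct n≥2 adj)) w) (labels-map (interpret g) κ w))

  lefts-interpret : ∀ g (l : List (Maybe (Fin a))) → lefts (map (interpret g) l) ≡ catMaybes l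
  lefts-interpret g []            = refl
  lefts-interpret g (just t ∷ l)  = cong (t ∷_) (lefts-interpret g l)
  lefts-interpret g (nothing ∷ l) = lefts-interpret g l

  rights-interpret : ∀ g (l : List (Maybe (Fin a))) → rights (map (interpret g) l) ≡ replicate (specials l) (rungColour g)
  rights-interpret g []            = refl
  rights-interpret g (just _ ∷ l)  = rights-interpret g l
  rights-interpret g (nothing ∷ l) = cong (rungColour g ∷_) (rights-interpret g l)

  route : ∀ {g m g' i j} → Walk Γ g m → Walk Cₙ i j → Walk Γ m g' → Walk ΓCₙ (g , i) (g' , j)
  route {i = i} {j} before path after = liftˡ i before ++ʷ (liftʳ _ path ++ʷ liftˡ j after)

  length-route : ∀ {g m g' i j} (before : Walk Γ g m) (path : Walk Cₙ i j) (after : Walk Γ m g') →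
                 length (route before path after) ≡ length (before ++ʷ after) + length path
  length-route {m = m} {i = i} {j} before path after = begin
    length (liftˡ i before ++ʷ (liftʳ m path ++ʷ liftˡ j after))
      ≡⟨ trans (length-++ʷ (liftˡ i before) _) (cong (length (liftˡ i before) +_) (length-++ʷ (liftʳ m path) _)) ⟩
    length (liftˡ i before) + (length (liftʳ m path) + length (liftˡ j after))
      ≡⟨ cong₂ _+_ (length-liftˡ i before) (cong₂ _+_ (length-liftʳ m path) (length-liftˡ j after)) ⟩
    length before + (length path + length after)   ≡⟨ regroup (length before) (length path) (length after) ⟩
    length before + length after + length path     ≡⟨ cong (_+ length path) (length-++ʷ before after) ⟨
    length (before ++ʷ after) + length path        ∎
    where
    open ≡-Reasoning
    regroup : ∀ x y z → x + (y + z) ≡ x + z + y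
    regroup = solve-∀

  labels-route : ∀ {g m g' i j} (before : Walk Γ g m) (path : Walk Cₙ i j) (after : Walk Γ m g') →
                 labels colour (route before path after)
                 ≡ map inj₂ (labels (layer (side i)) before) ++ map (interpret m) (labels κ path) ++ map inj₂ (labels (layer (side j)) after)
  labels-route {m = m} {i = i} {j} before path after = trans (labels-++ʷ colour (liftˡ i before) _)
    (cong₂ _++_ (labels-layer i before)
      (trans (labels-++ʷ colour (liftʳ m path) _) (cong₂ _++_ (labels-fibre m path) (labels-layer j after))))

  lefts-route : ∀ {g m g' i j} (before : Walk Γ g m) (path : Walk Cₙ i j) (after : Walk Γ m g') →
                lefts (labels colour (route before path after)) ≡ catMaybes (labels κ path)
  lefts-route {m = m} before path after = begin
    lefts (labels colour (route before path after))                ≡⟨ cong lefts (labels-route before path after) ⟩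
    lefts (map inj₂ B ++ map (interpret m) L ++ map inj₂ C)       ≡⟨ lefts-++ (map inj₂ B) _ ⟩
    lefts (map inj₂ B) ++ lefts (map (interpret m) L ++ map inj₂ C)
      ≡⟨ cong₂ _++_ (lefts-inj₂ B) (lefts-++ (map (interpret m) L) _) ⟩
    lefts (map (interpret m) L) ++ lefts (map inj₂ C)             ≡⟨ cong₂ _++_ (lefts-interpret m L) (lefts-inj₂ C) ⟩
    catMaybes L ++ []                                             ≡⟨ ++-identityʳ _ ⟩
    catMaybes L                                                   ∎
    where
    open ≡-Reasoning
    B = labels (layer _) before
    C = labels (layer _) after
    L = labels κ path

  rights-route : ∀ {g m g' i j} (before : Walk Γ g m) (path : Walk Cₙ i j) (after : Walk Γ m g') →
                 rights (labels colour (route before path after))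
                 ≡ labels (layer (side i)) before ++ replicate (specials (labels κ path)) (rungColour m) ++ labels (layer (side j)) after
  rights-route {m = m} before path after = begin
    rights (labels colour (route before path after))                ≡⟨ cong rights (labels-route before path after) ⟩
    rights (map inj₂ B ++ map (interpret m) L ++ map inj₂ C)       ≡⟨ rights-++ (map inj₂ B) _ ⟩
    rights (map inj₂ B) ++ rights (map (interpret m) L ++ map inj₂ C)
      ≡⟨ cong₂ _++_ (rights-inj₂ B) (rights-++ (map (interpret m) L) _) ⟩
    B ++ rights (map (interpret m) L) ++ rights (map inj₂ C)       ≡⟨ cong₂ (λ p q → B ++ p ++ q) (rights-interpret m L) (rights-inj₂ C) ⟩
    B ++ replicate (specials L) (rungColour m) ++ C                ∎
    where
    open ≡-Reasoning
    B = labels (layer _) before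
    C = labels (layer _) after
    L = labels κ path

  -- Decompose a rainbow geodesic of Γ □ C₂ from (g , side i) to (g' , side j) and
  -- replace its rung by an arc from i to j: the result is a rainbow geodesic of
  -- Γ □ C_n, since its second-summand colours are exactly those of the geodesic
  -- of Γ □ C₂ and its first-summand colours are the distinct colours of the arc.
  lift-arc : ∀ g g' {i j} → Arc i j → RainbowGeodesic ΓCₙ colour (g , i) (g' , j)
  lift-arc g g' {i} {j} A with prism-rainbow (g , side i) (g' , side j)
  ... | P , P-geo , P-rainbow = route before walk after , route-geodesic , route-rainbow
    where
    open Arc A
    open Decomposition (decompose P P-geo)
    route-rainbow : Unique (labels colour (route before walk after))
    route-rainbow = Unique-components _
      (subst Unique (sym (lefts-route before walk after)) rainbow)
      (subst Unique (sym (trans (rights-route before walk after)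
                                (trans (cong (λ r → labels (layer (side i)) before ++ replicate r (rungColour mid) ++ labels (layer (side j)) after) crossings)
                                       (sym labels-split))))
             P-rainbow)
    route-geodesic : IsGeodesic (route before walk after)
    route-geodesic = product-geodesic _ base-geodesic geodesic (≤-reflexive (length-route before walk after))

  rainbow-between : ∀ u v → RainbowGeodesic ΓCₙ colour u v
  rainbow-between (g , i) (g' , j) with arc i j
  ... | inj₁ A = lift-arc g g' A
  ... | inj₂ A = reverse-rainbow ΓCₙ-sym colour colour-symmetric (lift-arc g' g A)

  join-injective : ∀ {x y : Fin a ⊎ Fin k} → join a k x ≡ join a k y → x ≡ y
  join-injective {x} {y} eq = trans (sym (splitAt-join a k x)) (trans (cong (splitAt a) eq) (splitAt-join a k y))

  strong-rainbow : HasStrongRainbow ΓCₙ (a + k)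
  strong-rainbow = final , (λ u v e → cong (join a k) (colour-symmetric u v e)) , rainbow
    where
    final : V ΓCₙ → V ΓCₙ → Fin (a + k)
    final u v = join a k (colour u v)
    rainbow : ∀ u v → u ≢ v → Σ (Walk ΓCₙ u v) λ p → IsGeodesic p × Unique (colours final p)
    rainbow u v _ with recolour-rainbow (join a k) join-injective colour (rainbow-between u v)
    ... | p , p-geo , p-rainbow = p , p-geo , subst Unique (sym (colours≡labels final p)) p-rainbow

-- Proposition 2.4. With m = n - 2, the numbers a = ⌈m/2⌉ and b = ⌊m/2⌋ satisfy
-- b ≤ a ≤ b + 2 and a + b = m.
proposition2p4 : (N : ℕ) (adj : Fin N → Fin N → Set) →
    IsSimple (mkGraph (Fin N) adj) → Connected (mkGraph (Fin N) adj) →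
    (n : ℕ) → 3 ≤ n → (k : ℕ) →
    HasStrongRainbow (mkGraph (Fin N) adj □ Cycle 2) k →
    HasStrongRainbow (mkGraph (Fin N) adj □ Cycle n) (⌈ (n ∸ 2) /2⌉ + k)
proposition2p4 N adj (Γ-sym , _) _ (suc (suc m)) (s≤s (s≤s _)) k (ζ , ζ-strong) =
  subst (λ t → HasStrongRainbow (mkGraph (Fin N) adj □ Cycle (2 + t)) (⌈ m /2⌉ + k)) a+b≡m
    (LiftedColouring.strong-rainbow F._≟_ Γ-sym ⌈ m /2⌉ ⌊ m /2⌋ (⌊n/2⌋≤⌈n/2⌉ m) ⌈m/2⌉≤2+⌊m/2⌋ ζ ζ-strong)
  where
  a+b≡m : ⌈ m /2⌉ + ⌊ m /2⌋ ≡ m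
  a+b≡m = trans (+-comm ⌈ m /2⌉ ⌊ m /2⌋) (⌊n/2⌋+⌈n/2⌉≡n m)
  ⌈m/2⌉≤2+⌊m/2⌋ : ⌈ m /2⌉ ≤ 2 + ⌊ m /2⌋
  ⌈m/2⌉≤2+⌊m/2⌋ = m≤n⇒m≤1+n (⌊n/2⌋-mono (n≤1+n (suc m)))
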